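{- For $n,k,\ell\ge0$, the number of independent sets of size $k$ of the graph $\mathcal{UDC}(B_n)$ that occupy exactly $\ell$ rows is the coefficient of $x^ny^kz^\ell$ in \[F_{\mathcal{UDC}}(x,y,z)=\frac{1-x-xy}{x^2y-xyz+x^2-xy-2x+1}.\]
   Context: $B_n=\{(i,j):1\le i\le j\le n\}$ ($B_0=\emptyset$), with $i$ the row and $j$ the column. $\mathcal{UDC}(B_n)$ is the graph on vertex set $B_n$ in which distinct $(i,j),(k,\ell)$ are adjacent iff at least one of: $i>k$ and $j<\ell$ (or the same with the two cells swapped); $i<k$, $j<\ell$ and $\{i,\dots,k\}\times\{j,\dots,\ell\}\subseteq B_n$ (or the same with the two cells swapped); $j=\ell$. An independent set $I$ occupies the rows $\{i:(i,j)\in I\text{ for some }j\}$. The empty set counts as an independent set (of $B_n$ for every $n\ge0$). -}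

module Defs where

open import Data.Nat using (ℕ; zero; suc; _+_; _∸_; _≡ᵇ_; _<ᵇ_; _≤ᵇ_)
open import Data.Bool using (Bool; true; false; _∧_; _∨_; not; if_then_else_)
open import Data.List using (List; []; _∷_; _++_; map; length; concatMap)
open import Data.Product using (_×_; _,_)
open import Relation.Binary.PropositionalEquality using (_≡_)
open import Data.Integer using (ℤ; +_; -_) renaming (_+_ to _+ℤ_; _*_ to _*ℤ_)

range : ℕ → ℕ → List ℕ          -- range a b = [a, a+1, ..., b] (empty if b < a)
range a b = go (suc b ∸ a) a
  where
  go : ℕ → ℕ → List ℕ
  go zero    _ = []
  go (suc m) x = x ∷ go m (suc x)

allᵇ : {A : Set} → (A → Bool) → List A → Bool
allᵇ p []       = true
allᵇ p (x ∷ xs) = p x ∧ allᵇ p xs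

anyᵇ : {A : Set} → (A → Bool) → List A → Bool
anyᵇ p []       = false
anyᵇ p (x ∷ xs) = p x ∨ anyᵇ p xs

countᵇ : {A : Set} → (A → Bool) → List A → ℕ
countᵇ p []       = 0
countᵇ p (x ∷ xs) = (if p x then 1 else 0) + countᵇ p xs

-- A cell (i , j): i is the row, j the column.
Cell : Set
Cell = ℕ × ℕ

row : Cell → ℕ
row (i , _) = i

_==ᶜ_ : Cell → Cell → Bool
(i , j) ==ᶜ (k , l) = (i ≡ᵇ k) ∧ (j ≡ᵇ l)

inBᵇ : ℕ → Cell → Bool
inBᵇ n (i , j) = (1 ≤ᵇ i) ∧ (i ≤ᵇ j) ∧ (j ≤ᵇ n)

cells : ℕ → List Cell
cells n = concatMap (λ i → map (λ j → (i , j)) (range i n)) (range 1 n)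

rectInBᵇ : ℕ → ℕ → ℕ → ℕ → ℕ → Bool
rectInBᵇ n i k j l =
  allᵇ (λ r → allᵇ (λ c → inBᵇ n (r , c)) (range j l)) (range i k)

adjDirᵇ : ℕ → Cell → Cell → Bool
adjDirᵇ n (i , j) (k , l) =
     ((k <ᵇ i) ∧ (j <ᵇ l))
  ∨ ((i <ᵇ k) ∧ (j <ᵇ l) ∧ rectInBᵇ n i k j l)
  ∨ (j ≡ᵇ l)

adjᵇ : ℕ → Cell → Cell → Bool
adjᵇ n c d = not (c ==ᶜ d) ∧ (adjDirᵇ n c d ∨ adjDirᵇ n d c)

-- a set of cells (given as a duplicate-free list) is independent
independentᵇ : ℕ → List Cell → Bool
independentᵇ n I = allᵇ (λ c → allᵇ (λ d → not (adjᵇ n c d)) I) I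

rowsOccupied : ℕ → List Cell → ℕ
rowsOccupied n I = countᵇ (λ r → anyᵇ (λ c → row c ≡ᵇ r) I) (range 1 n)

subsets : {A : Set} → List A → List (List A)
subsets []       = [] ∷ []
subsets (x ∷ xs) = subsets xs ++ map (x ∷_) (subsets xs)

numIndep : ℕ → ℕ → ℕ → ℕ
numIndep n k ℓ =
  countᵇ (λ I → independentᵇ n I ∧ (length I ≡ᵇ k) ∧ (rowsOccupied n I ≡ᵇ ℓ))
         (subsets (cells n))

-- Formal power series in x, y, z over ℤ: coefficient functions (n,k,ℓ) ↦ [x^n y^k z^ℓ]
Series3 : Set
Series3 = ℕ → ℕ → ℕ → ℤ

sumℤ : List ℤ → ℤ
sumℤ []       = + 0
sumℤ (x ∷ xs) = x +ℤ sumℤ xs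

_⋆_ : Series3 → Series3 → Series3
(f ⋆ g) n k ℓ =
  sumℤ (concatMap (λ a → concatMap (λ b → map (λ c →
           f a b c *ℤ g (n ∸ a) (k ∸ b) (ℓ ∸ c))
         (range 0 ℓ)) (range 0 k)) (range 0 n))

numer : Series3
numer 0 0 0 = + 1
numer 1 0 0 = - (+ 1)
numer 1 1 0 = - (+ 1)
numer _ _ _ = + 0

denom : Series3
denom 2 1 0 = + 1
denom 1 1 1 = - (+ 1)
denom 2 0 0 = + 1
denom 1 1 0 = - (+ 1)
denom 1 0 0 = - (+ 2)
denom 0 0 0 = + 1
denom _ _ _ = + 0

-- A is the power series numer / denom  (denom has constant term 1, so this
-- characterises A uniquely)  iff  denom ⋆ A = numer coefficientwise.
IsQuotient : Series3 → Series3 → Series3 → Set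
IsQuotient A p q = ∀ n k ℓ → (q ⋆ A) n k ℓ ≡ p n k ℓ

-- An independent set of UDC(B_n) is a choice of occupied rows a₁ < ⋯ < a_ℓ together with, in
-- each row a_i, a nonempty set of columns all smaller than a_(i+1): cells of one row are never
-- adjacent, and cells (a , x), (r , y) with a < r are adjacent exactly when r ≤ x. Reading B_n row
-- by row, and its first row column by column, gives recurrences for the number ind of independent
-- sets and the number indTop of those meeting the first row. Eliminating indTop yields
--   ind(n+2,k+1,ℓ+1) − 2 ind(n+1,k+1,ℓ+1) + ind(n,k+1,ℓ+1)
--     − ind(n+1,k,ℓ+1) + ind(n,k,ℓ+1) − ind(n+1,k,ℓ) = 0,
-- the coefficient of x^(n+2) y^(k+1) z^(ℓ+1) in denom · F = numer; the remaining coefficients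
-- (n ≤ 1, k = 0 or ℓ = 0) are finite computations.
module Submission where

open import Algebra.Bundles using (CommutativeMonoid)
open import Data.Bool using (Bool; true; false; _∧_; _∨_; not; if_then_else_)
open import Data.Bool.Properties
  using (∧-assoc; ∧-idem; ∧-zeroʳ; ∨-assoc; ∨-comm; ∨-zeroʳ; ∧-commutativeMonoid)
open import Algebra.Properties.CommutativeSemigroup (CommutativeMonoid.commutativeSemigroup ∧-commutativeMonoid)
  using () renaming (interchange to ∧-interchange)
open import Data.List using (List; []; _∷_; _++_; map; length; concatMap)
open import Data.List.Properties using (length-++; ++-assoc; map-cong; concatMap-cong)
open import Data.List.Membership.Propositional using (_∈_)
open import Data.List.Membership.Propositional.Properties using (∈-++⁺ˡ; ∈-++⁺ʳ)
open import Data.List.Relation.Unary.All as All using (All; []; _∷_)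
open import Data.List.Relation.Unary.All.Properties using (++⁺; map⁺; concat⁺)
open import Data.List.Relation.Unary.Any using (here; there)
open import Data.Nat
open import Data.Nat.Induction using (<-wellFounded)
open import Data.Nat.Properties
open import Data.Product using (_×_; _,_; proj₁; proj₂)
open import Function using (_∘_; case_of_)
import Induction.WellFounded as WF
open import Level using (0ℓ)
open import Relation.Binary.Definitions using (tri<; tri≈; tri>)
import Relation.Binary.Construct.On as On
open import Relation.Binary.PropositionalEquality
open import Relation.Nullary using (¬_; yes; no; contradiction)
open import Relation.Nullary.Reflects using (Reflects; ofʸ; ofⁿ; det; fromEquivalence)

open import Defs

private
  variable
    A B : Set
    x : A
    xs ys : List A
    p q : A → Bool

reflects-true : ∀ {P : Set} {b} → Reflects P b → P → b ≡ true
reflects-true r x = det r (ofʸ x)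

reflects-false : ∀ {P : Set} {b} → Reflects P b → ¬ P → b ≡ false
reflects-false r ¬x = det r (ofⁿ ¬x)

≡ᵇ-reflects-≡ : ∀ m n → Reflects (m ≡ n) (m ≡ᵇ n)
≡ᵇ-reflects-≡ m n = fromEquivalence (≡ᵇ⇒≡ m n) (≡⇒≡ᵇ m n)

≡ᵇ-sym : ∀ m n → (m ≡ᵇ n) ≡ (n ≡ᵇ m)
≡ᵇ-sym zero    zero    = refl
≡ᵇ-sym zero    (suc n) = refl
≡ᵇ-sym (suc m) zero    = refl
≡ᵇ-sym (suc m) (suc n) = ≡ᵇ-sym m n

≡ᵇ-+ˡ : ∀ m n o → ((m + n) ≡ᵇ (m + o)) ≡ (n ≡ᵇ o)
≡ᵇ-+ˡ zero    n o = refl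
≡ᵇ-+ˡ (suc m) n o = ≡ᵇ-+ˡ m n o

allᵇ-++ : ∀ (p : A → Bool) xs ys → allᵇ p (xs ++ ys) ≡ allᵇ p xs ∧ allᵇ p ys
allᵇ-++ p []       ys = refl
allᵇ-++ p (x ∷ xs) ys = trans (cong (p x ∧_) (allᵇ-++ p xs ys)) (sym (∧-assoc (p x) _ _))

anyᵇ-++ : ∀ (p : A → Bool) xs ys → anyᵇ p (xs ++ ys) ≡ anyᵇ p xs ∨ anyᵇ p ys
anyᵇ-++ p []       ys = refl
anyᵇ-++ p (x ∷ xs) ys = trans (cong (p x ∨_) (anyᵇ-++ p xs ys)) (sym (∨-assoc (p x) _ _))

allᵇ-cong : All (λ x → p x ≡ q x) xs → allᵇ p xs ≡ allᵇ q xs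
allᵇ-cong []       = refl
allᵇ-cong (e ∷ es) = cong₂ _∧_ e (allᵇ-cong es)

allᵇ-∧ : ∀ (p q : A → Bool) xs → allᵇ (λ x → p x ∧ q x) xs ≡ allᵇ p xs ∧ allᵇ q xs
allᵇ-∧ p q []       = refl
allᵇ-∧ p q (x ∷ xs) = trans (cong ((p x ∧ q x) ∧_) (allᵇ-∧ p q xs)) (∧-interchange (p x) (q x) _ _)

allᵇ-true : All (λ x → p x ≡ true) xs → allᵇ p xs ≡ true
allᵇ-true []       = refl
allᵇ-true (e ∷ es) rewrite e = allᵇ-true es

allᵇ-false : x ∈ xs → p x ≡ false → allᵇ p xs ≡ false
allᵇ-false {p = p} (here refl) e rewrite e = refl
allᵇ-false {xs = y ∷ _} {p = p} (there x∈xs) e =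
  trans (cong (p y ∧_) (allᵇ-false x∈xs e)) (∧-zeroʳ (p y))

anyᵇ-true : x ∈ xs → p x ≡ true → anyᵇ p xs ≡ true
anyᵇ-true {p = p} (here refl) e rewrite e = refl
anyᵇ-true {xs = y ∷ _} {p = p} (there x∈xs) e =
  trans (cong (p y ∨_) (anyᵇ-true x∈xs e)) (∨-zeroʳ (p y))

anyᵇ-false : All (λ x → p x ≡ false) xs → anyᵇ p xs ≡ false
anyᵇ-false []       = refl
anyᵇ-false (e ∷ es) rewrite e = anyᵇ-false es

allᵇ-swap : ∀ (p : A → B → Bool) xs ys →
  allᵇ (λ x → allᵇ (p x) ys) xs ≡ allᵇ (λ y → allᵇ (λ x → p x y) xs) ys
allᵇ-swap p []       ys = sym (allᵇ-true (All.universal (λ _ → refl) ys))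
allᵇ-swap p (x ∷ xs) ys =
  trans (cong (allᵇ (p x) ys ∧_) (allᵇ-swap p xs ys)) (sym (allᵇ-∧ (p x) _ ys))

countᵇ-++ : ∀ (p : A → Bool) xs ys → countᵇ p (xs ++ ys) ≡ countᵇ p xs + countᵇ p ys
countᵇ-++ p []       ys = refl
countᵇ-++ p (x ∷ xs) ys = trans (cong (_ +_) (countᵇ-++ p xs ys)) (sym (+-assoc (if p x then 1 else 0) _ _))

countᵇ-map : ∀ (f : B → A) xs → countᵇ p (map f xs) ≡ countᵇ (p ∘ f) xs
countᵇ-map f []       = refl
countᵇ-map f (x ∷ xs) = cong (_ +_) (countᵇ-map f xs)

countᵇ-cong : All (λ x → p x ≡ q x) xs → countᵇ p xs ≡ countᵇ q xs
countᵇ-cong []       = refl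
countᵇ-cong (e ∷ es) rewrite e = cong (_ +_) (countᵇ-cong es)

countᵇ-none : All (λ x → p x ≡ false) xs → countᵇ p xs ≡ 0
countᵇ-none []       = refl
countᵇ-none (e ∷ es) rewrite e = countᵇ-none es

countᵇ-pos : x ∈ xs → p x ≡ true → 0 < countᵇ p xs
countᵇ-pos {p = p} (here refl) e rewrite e = s≤s z≤n
countᵇ-pos {xs = y ∷ _} {p = p} (there x∈xs) e =
  ≤-trans (countᵇ-pos x∈xs e) (m≤n+m _ (if p y then 1 else 0))

countᵇ-∨ : All (λ x → p x ∧ q x ≡ false) xs →
  countᵇ (λ x → p x ∨ q x) xs ≡ countᵇ p xs + countᵇ q xs
countᵇ-∨ []                           = refl
countᵇ-∨ {p = p} {q} {x ∷ _} (e ∷ es) = trans (cong (_ +_) (countᵇ-∨ es)) (disjoint (p x) (q x) e)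
  where
  disjoint : ∀ b c {m n} → b ∧ c ≡ false →
    (if b ∨ c then 1 else 0) + (m + n) ≡ ((if b then 1 else 0) + m) + ((if c then 1 else 0) + n)
  disjoint true  false _ = refl
  disjoint false true  _ = sym (+-suc _ _)
  disjoint false false _ = refl

countᵇ-subsets-∷ : ∀ (p : List A → Bool) x xs →
  countᵇ p (subsets (x ∷ xs)) ≡ countᵇ p (subsets xs) + countᵇ (λ I → p (x ∷ I)) (subsets xs)
countᵇ-subsets-∷ p x xs =
  trans (countᵇ-++ p (subsets xs) _) (cong (countᵇ p (subsets xs) +_) (countᵇ-map (x ∷_) (subsets xs)))

subsets⁺ : ∀ {P : A → Set} → All P xs → All (All P) (subsets xs)
subsets⁺ []         = [] ∷ []
subsets⁺ (px ∷ pxs) = ++⁺ (subsets⁺ pxs) (map⁺ (All.map (px ∷_) (subsets⁺ pxs)))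

countᵇ-subsets-skip : ∀ (g : A → Bool) (P : List A → Bool) xs ys → All (λ x → g x ≡ false) xs →
  countᵇ (λ J → allᵇ g J ∧ P J) (subsets (xs ++ ys)) ≡ countᵇ (λ J → allᵇ g J ∧ P J) (subsets ys)
countᵇ-subsets-skip g P []       ys []         = refl
countᵇ-subsets-skip g P (x ∷ xs) ys (gx ∷ gxs) = begin
  countᵇ Q (subsets (x ∷ xs ++ ys))
    ≡⟨ countᵇ-subsets-∷ Q x (xs ++ ys) ⟩
  countᵇ Q (subsets (xs ++ ys)) + countᵇ (λ J → Q (x ∷ J)) (subsets (xs ++ ys))
    ≡⟨ cong₂ _+_ (countᵇ-subsets-skip g P xs ys gxs)
                 (countᵇ-none (All.universal (λ J → cong (λ b → (b ∧ allᵇ g J) ∧ P (x ∷ J)) gx)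
                                             (subsets (xs ++ ys)))) ⟩
  countᵇ Q (subsets ys) + 0
    ≡⟨ +-identityʳ _ ⟩
  countᵇ Q (subsets ys) ∎
  where
  open ≡-Reasoning
  Q : List _ → Bool
  Q J = allᵇ g J ∧ P J

-- range a b recurses on its length suc b ∸ a, so it unfolds once that length is abstracted.
range-suc : ∀ {a b} → a ≤ b → range a b ≡ a ∷ range (suc a) b
range-suc {a} {b} a≤b with suc b ∸ a | +-∸-assoc 1 a≤b
... | .(suc (b ∸ a)) | refl = refl

range-empty : ∀ {a b} → b < a → range a b ≡ []
range-empty {a} {b} b<a with suc b ∸ a | m≤n⇒m∸n≡0 b<a
... | .0 | refl = refl

range-ind : ∀ (P : ℕ → List ℕ → Set) {b} →
  (∀ {a} → b < a → P a []) →
  (∀ {a} → a ≤ b → P (suc a) (range (suc a) b) → P a (a ∷ range (suc a) b)) →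
  ∀ a → P a (range a b)
range-ind P {b} empty step a = go (suc b ∸ a) a ≤-refl
  where
  go : ∀ t a → suc b ∸ a ≤ t → P a (range a b)
  go t a fuel with b <? a
  ... | yes b<a rewrite range-empty b<a = empty b<a
  go zero    a fuel | no b≮a = contradiction (m∸n≡0⇒m≤n (n≤0⇒n≡0 fuel)) b≮a
  go (suc t) a fuel | no b≮a rewrite range-suc (≮⇒≥ b≮a) =
    step (≮⇒≥ b≮a) (go t (suc a) (≤-pred (subst (_≤ suc t) (+-∸-assoc 1 (≮⇒≥ b≮a)) fuel)))

range-bounds : ∀ a b → All (λ i → a ≤ i × i ≤ b) (range a b)
range-bounds a b = range-ind (λ a is → All (λ i → a ≤ i × i ≤ b) is) (λ _ → [])
  (λ a≤b rest → (≤-refl , a≤b) ∷ All.map (λ (a<i , i≤b) → <⇒≤ a<i , i≤b) rest) a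

∈-range : ∀ {a b i} → a ≤ i → i ≤ b → i ∈ range a b
∈-range {a} {b} {i} = range-ind (λ a is → a ≤ i → i ≤ b → i ∈ is)
  (λ b<a a≤i i≤b → contradiction (≤-<-trans i≤b b<a) (≤⇒≯ a≤i))
  (λ {a} _ rest a≤i i≤b → case a ≟ i of λ where
     (yes refl) → here refl
     (no a≢i)   → there (rest (≤∧≢⇒< a≤i a≢i) i≤b)) a

countᵇ-range-once : ∀ {a b i} → a ≤ i → i ≤ b → countᵇ (i ≡ᵇ_) (range a b) ≡ 1
countᵇ-range-once {a} {b} {i} = range-ind (λ a is → a ≤ i → i ≤ b → countᵇ (i ≡ᵇ_) is ≡ 1)
  (λ b<a a≤i i≤b → contradiction (≤-<-trans i≤b b<a) (≤⇒≯ a≤i)) step a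
  where
  step : ∀ {a} → a ≤ b → (suc a ≤ i → i ≤ b → countᵇ (i ≡ᵇ_) (range (suc a) b) ≡ 1) →
         a ≤ i → i ≤ b → countᵇ (i ≡ᵇ_) (a ∷ range (suc a) b) ≡ 1
  step {a} _ rest a≤i i≤b with a ≟ i
  ... | yes refl rewrite reflects-true (≡ᵇ-reflects-≡ a a) refl =
    cong suc (countᵇ-none (All.map (λ (a<j , _) → reflects-false (≡ᵇ-reflects-≡ a _) (<⇒≢ a<j))
                                   (range-bounds (suc a) b)))
  ... | no a≢i rewrite reflects-false (≡ᵇ-reflects-≡ i a) (a≢i ∘ sym) =
    rest (≤∧≢⇒< a≤i a≢i) i≤b

-- The board B_n and adjacency in UDC(B_n)

col : Cell → ℕ
col (_ , j) = j

cellsFrom : ℕ → ℕ → List Cell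
cellsFrom n a = concatMap (λ i → map (λ j → (i , j)) (range i n)) (range a n)

cellsFrom-suc : ∀ {n a} → a ≤ n → cellsFrom n a ≡ map (a ,_) (range a n) ++ cellsFrom n (suc a)
cellsFrom-suc a≤n = cong (concatMap _) (range-suc a≤n)

cellsFrom-empty : ∀ {n a} → n < a → cellsFrom n a ≡ []
cellsFrom-empty n<a = cong (concatMap _) (range-empty n<a)

RowsFrom : ℕ → ℕ → Cell → Set
RowsFrom n a (i , j) = a ≤ i × i ≤ j × j ≤ n

cellsFrom-rows : ∀ n a → All (RowsFrom n a) (cellsFrom n a)
cellsFrom-rows n a = concat⁺ (map⁺ (All.map
  (λ {i} (a≤i , _) → map⁺ (All.map (λ (i≤j , j≤n) → a≤i , i≤j , j≤n) (range-bounds i n)))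
  (range-bounds a n)))

inBᵇ-true : ∀ {n i j} → 1 ≤ i → i ≤ j → j ≤ n → inBᵇ n (i , j) ≡ true
inBᵇ-true {n} {i} {j} 1≤i i≤j j≤n
  rewrite reflects-true (≤ᵇ-reflects-≤ 1 i) 1≤i | reflects-true (≤ᵇ-reflects-≤ i j) i≤j
        | reflects-true (≤ᵇ-reflects-≤ j n) j≤n = refl

inBᵇ-false : ∀ {n i j} → j < i → inBᵇ n (i , j) ≡ false
inBᵇ-false {n} {i} {j} j<i rewrite reflects-false (≤ᵇ-reflects-≤ i j) (<⇒≱ j<i) = ∧-zeroʳ (1 ≤ᵇ i)

rectInBᵇ-true : ∀ {n i k j l} → 1 ≤ i → k ≤ j → l ≤ n → rectInBᵇ n i k j l ≡ true
rectInBᵇ-true {i = i} {k} {j} {l} 1≤i k≤j l≤n = allᵇ-true (All.map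
  (λ (i≤r , r≤k) → allᵇ-true (All.map
     (λ (j≤c , c≤l) → inBᵇ-true (≤-trans 1≤i i≤r) (≤-trans r≤k (≤-trans k≤j j≤c))
                                 (≤-trans c≤l l≤n))
     (range-bounds j l)))
  (range-bounds i k))

rectInBᵇ-false : ∀ {n i k j l} → i ≤ k → j < k → j ≤ l → rectInBᵇ n i k j l ≡ false
rectInBᵇ-false i≤k j<k j≤l =
  allᵇ-false (∈-range i≤k ≤-refl) (allᵇ-false (∈-range ≤-refl j≤l) (inBᵇ-false j<k))

adjᵇ-sym : ∀ n c d → adjᵇ n c d ≡ adjᵇ n d c
adjᵇ-sym n (i , j) (k , l) =
  cong₂ (λ e f → not e ∧ f) (cong₂ _∧_ (≡ᵇ-sym i k) (≡ᵇ-sym j l))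
    (∨-comm (adjDirᵇ n (i , j) (k , l)) (adjDirᵇ n (k , l) (i , j)))

adjᵇ-sameRow : ∀ n i j l → adjᵇ n (i , j) (i , l) ≡ false
adjᵇ-sameRow n i j l
  rewrite reflects-true (≡ᵇ-reflects-≡ i i) refl | reflects-false (<ᵇ-reflects-< i i) (n≮n i)
        | ≡ᵇ-sym l j with j ≡ᵇ l
... | true  = refl
... | false = refl

-- If j < k the rectangle spanned by the two cells contains (k , j) ∉ B_n; if k ≤ j it lies in B_n.
notAdjᵇ-rows : ∀ n {i j k l} → 1 ≤ i → i < k → k ≤ l → l ≤ n →
  not (adjᵇ n (i , j) (k , l)) ≡ (j <ᵇ k)
notAdjᵇ-rows n {i} {j} {k} {l} 1≤i i<k k≤l l≤n
  rewrite reflects-false (≡ᵇ-reflects-≡ i k) (<⇒≢ i<k) | reflects-false (<ᵇ-reflects-< k i) (<⇒≯ i<k)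
        | reflects-true (<ᵇ-reflects-< i k) i<k
  with j <? k
... | yes j<k
  rewrite reflects-true (<ᵇ-reflects-< j k) j<k | reflects-true (<ᵇ-reflects-< j l) (<-≤-trans j<k k≤l)
        | rectInBᵇ-false {n} (<⇒≤ i<k) j<k (<⇒≤ (<-≤-trans j<k k≤l))
        | reflects-false (≡ᵇ-reflects-≡ j l) (<⇒≢ (<-≤-trans j<k k≤l))
        | reflects-false (<ᵇ-reflects-< l j) (<⇒≯ (<-≤-trans j<k k≤l))
        | reflects-false (≡ᵇ-reflects-≡ l j) (<⇒≢ (<-≤-trans j<k k≤l) ∘ sym) = refl
... | no j≮k
  rewrite reflects-false (<ᵇ-reflects-< j k) j≮k
        | rectInBᵇ-true {n} {i} {k} {j} {l} 1≤i (≮⇒≥ j≮k) l≤n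
  with <-cmp j l
... | tri< j<l _ _ rewrite reflects-true (<ᵇ-reflects-< j l) j<l = refl
... | tri≈ _ refl _
  rewrite reflects-true (≡ᵇ-reflects-≡ j j) refl | ∨-comm ((j <ᵇ j) ∧ true) true = refl
... | tri> _ _ l<j rewrite reflects-true (<ᵇ-reflects-< l j) l<j = cong not (∨-zeroʳ _)

-- Counting independent sets row by row

-- ind t k ℓ counts the independent sets of UDC(B_t) with k cells in ℓ rows, indTop t k ℓ
-- those meeting row 1, and indTop₁ t k ℓ those of UDC(B_(t+1)) containing the cell (1 , 1).
mutual
  ind : ℕ → ℕ → ℕ → ℕ
  ind zero    zero zero = 1
  ind zero    _    _    = 0
  ind (suc t) k    ℓ    = ind t k ℓ + indTop (suc t) k ℓ

  indTop : ℕ → ℕ → ℕ → ℕ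
  indTop zero    k ℓ = 0
  indTop (suc t) k ℓ = indTop t k ℓ + indTop₁ t k ℓ

  indTop₁ : ℕ → ℕ → ℕ → ℕ
  indTop₁ t (suc k) (suc ℓ) = ind t k ℓ + indTop t k (suc ℓ)
  indTop₁ t _       _       = 0

indTop-size₀ : ∀ t ℓ → indTop t 0 ℓ ≡ 0
indTop-size₀ zero    ℓ = refl
indTop-size₀ (suc t) ℓ = trans (+-identityʳ _) (indTop-size₀ t ℓ)

indTop-rows₀ : ∀ t k → indTop t k 0 ≡ 0
indTop-rows₀ zero    k       = refl
indTop-rows₀ (suc t) zero    = trans (+-identityʳ _) (indTop-rows₀ t 0)
indTop-rows₀ (suc t) (suc k) = trans (+-identityʳ _) (indTop-rows₀ t (suc k))

ind-size₀ : ∀ t ℓ → ind t 0 ℓ ≡ ind 0 0 ℓ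
ind-size₀ zero    ℓ = refl
ind-size₀ (suc t) ℓ =
  trans (cong (ind t 0 ℓ +_) (indTop-size₀ (suc t) ℓ)) (trans (+-identityʳ _) (ind-size₀ t ℓ))

ind-rows₀ : ∀ t k → ind t k 0 ≡ ind 0 k 0
ind-rows₀ zero    k = refl
ind-rows₀ (suc t) k =
  trans (cong (ind t k 0 +_) (indTop-rows₀ (suc t) k)) (trans (+-identityʳ _) (ind-rows₀ t k))

ind-recurrence : ∀ n k ℓ →
  ind (2 + n) (suc k) (suc ℓ) + ind n (suc k) (suc ℓ) + ind n k (suc ℓ) ≡
  ind (1 + n) (suc k) (suc ℓ) + ind (1 + n) (suc k) (suc ℓ) + ind (1 + n) k (suc ℓ) + ind (1 + n) k ℓ
ind-recurrence n k ℓ =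
  shuffle (ind n (suc k) (suc ℓ)) (indTop (1 + n) (suc k) (suc ℓ)) (ind (1 + n) k ℓ)
          (ind n k (suc ℓ)) (indTop (1 + n) k (suc ℓ))
  where
  open import Data.Nat.Tactic.RingSolver using (solve-∀)
  shuffle : ∀ h v f g w → (h + v) + (v + (f + w)) + h + g ≡ (h + v) + (h + v) + (g + w) + f
  shuffle = solve-∀

module Counting (n : ℕ) where

  countedᵇ : ℕ → ℕ → List Cell → Bool
  countedᵇ k ℓ I = independentᵇ n I ∧ (length I ≡ᵇ k) ∧ (rowsOccupied n I ≡ᵇ ℓ)

  count : ℕ → ℕ → ℕ → ℕ
  count a k ℓ = countᵇ (countedᵇ k ℓ) (subsets (cellsFrom n a))

  afterRowᵇ : ℕ → List Cell → Bool
  afterRowᵇ m = allᵇ (λ c → m <ᵇ row c)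

  InRow : ℕ → ℕ → Cell → Set
  InRow a m (i , j) = i ≡ a × a ≤ j × j ≤ m

  record RowPrefix (a m : ℕ) (pre : List Cell) : Set where
    field
      inRow   : All (InRow a m) pre
      lastCol : (a , m) ∈ pre

  RowPrefix-a≤m : ∀ {a m pre} → RowPrefix a m pre → a ≤ m
  RowPrefix-a≤m prefix = proj₁ (proj₂ (All.lookup (RowPrefix.inRow prefix) (RowPrefix.lastCol prefix)))

  countedᵇ-tooBig : ∀ {k} ℓ pre J → k < length pre → countedᵇ k ℓ (pre ++ J) ≡ false
  countedᵇ-tooBig {k} ℓ pre J k<pre
    rewrite reflects-false (≡ᵇ-reflects-≡ (length (pre ++ J)) k)
              (<⇒≢ (<-≤-trans k<pre (≤-trans (m≤m+n _ _) (≤-reflexive (sym (length-++ pre))))) ∘ sym)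
    = ∧-zeroʳ _

  countedᵇ-noRows : ∀ {a x} k I → 1 ≤ a → a ≤ n → (a , x) ∈ I → countedᵇ k 0 I ≡ false
  countedᵇ-noRows {a} k I 1≤a a≤n ax∈I
    rewrite reflects-false (≡ᵇ-reflects-≡ (rowsOccupied n I) 0)
              (<⇒≢ (countᵇ-pos (∈-range 1≤a a≤n)
                               (anyᵇ-true ax∈I (reflects-true (≡ᵇ-reflects-≡ a a) refl))) ∘ sym)
    = trans (cong (independentᵇ n I ∧_) (∧-zeroʳ _)) (∧-zeroʳ _)

  module _ {a m pre} (1≤a : 1 ≤ a) (m≤n : m ≤ n) (prefix : RowPrefix a m pre) where

    open RowPrefix prefix

    private
      a≤n : a ≤ n
      a≤n = ≤-trans (RowPrefix-a≤m prefix) m≤n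

      crossing : ∀ {c d} → InRow a m c → RowsFrom n (suc a) d → not (adjᵇ n c d) ≡ (col c <ᵇ row d)
      crossing {_ , j} {r , y} (refl , _) (a<r , r≤y , y≤n) = notAdjᵇ-rows n 1≤a a<r r≤y y≤n

      cols-before : ∀ r → allᵇ (λ c → col c <ᵇ r) pre ≡ (m <ᵇ r)
      cols-before r with m <? r
      ... | yes m<r = trans (allᵇ-true (All.map (λ {c} (_ , _ , j≤m) →
                                              reflects-true (<ᵇ-reflects-< (col c) r) (≤-<-trans j≤m m<r))
                                            inRow))
                            (sym (reflects-true (<ᵇ-reflects-< m r) m<r))
      ... | no m≮r  = trans (allᵇ-false lastCol (reflects-false (<ᵇ-reflects-< m r) m≮r))
                            (sym (reflects-false (<ᵇ-reflects-< m r) m≮r))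

      rows-of-prefix : ∀ r → anyᵇ (λ c → row c ≡ᵇ r) pre ≡ (a ≡ᵇ r)
      rows-of-prefix r with a ≟ r
      ... | yes a≡r = trans (anyᵇ-true lastCol (reflects-true (≡ᵇ-reflects-≡ a r) a≡r))
                            (sym (reflects-true (≡ᵇ-reflects-≡ a r) a≡r))
      ... | no a≢r  = trans (anyᵇ-false (All.map (λ { {_ , _} (refl , _) →
                                                     reflects-false (≡ᵇ-reflects-≡ a r) a≢r })
                                                  inRow))
                            (sym (reflects-false (≡ᵇ-reflects-≡ a r) a≢r))

    independentᵇ-split : ∀ {J} → All (RowsFrom n (suc a)) J →
      independentᵇ n (pre ++ J) ≡ afterRowᵇ m J ∧ independentᵇ n J
    independentᵇ-split {J} later = begin
      independentᵇ n (pre ++ J)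
        ≡⟨ allᵇ-++ (λ c → allᵇ (notAdj c) (pre ++ J)) pre J ⟩
      allᵇ (λ c → allᵇ (notAdj c) (pre ++ J)) pre ∧ allᵇ (λ c → allᵇ (notAdj c) (pre ++ J)) J
        ≡⟨ cong₂ _∧_ from-prefix from-later ⟩
      afterRowᵇ m J ∧ (afterRowᵇ m J ∧ independentᵇ n J)
        ≡⟨ sym (∧-assoc (afterRowᵇ m J) _ _) ⟩
      (afterRowᵇ m J ∧ afterRowᵇ m J) ∧ independentᵇ n J
        ≡⟨ cong (_∧ independentᵇ n J) (∧-idem (afterRowᵇ m J)) ⟩
      afterRowᵇ m J ∧ independentᵇ n J ∎
      where
      open ≡-Reasoning
      notAdj : Cell → Cell → Bool
      notAdj c d = not (adjᵇ n c d)

      from-prefix : allᵇ (λ c → allᵇ (notAdj c) (pre ++ J)) pre ≡ afterRowᵇ m J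
      from-prefix = begin
        allᵇ (λ c → allᵇ (notAdj c) (pre ++ J)) pre
          ≡⟨ allᵇ-cong (All.map (λ {c} c∈row → trans (allᵇ-++ (notAdj c) pre J)
               (cong₂ _∧_ (allᵇ-true (All.map (λ { {_ , _} (refl , _) → same-row c∈row }) inRow))
                          (allᵇ-cong (All.map (crossing c∈row) later))))
               inRow) ⟩
        allᵇ (λ c → allᵇ (λ d → col c <ᵇ row d) J) pre
          ≡⟨ allᵇ-swap (λ c d → col c <ᵇ row d) pre J ⟩
        allᵇ (λ d → allᵇ (λ c → col c <ᵇ row d) pre) J
          ≡⟨ allᵇ-cong (All.universal (λ d → cols-before (row d)) J) ⟩
        afterRowᵇ m J ∎
        where
        same-row : ∀ {c j} → InRow a m c → notAdj c (a , j) ≡ true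
        same-row {_ , i} {j} (refl , _) = cong not (adjᵇ-sameRow n a i j)

      from-later : allᵇ (λ c → allᵇ (notAdj c) (pre ++ J)) J ≡ afterRowᵇ m J ∧ independentᵇ n J
      from-later = begin
        allᵇ (λ c → allᵇ (notAdj c) (pre ++ J)) J
          ≡⟨ allᵇ-cong (All.map (λ {d} d-later → trans (allᵇ-++ (notAdj d) pre J)
               (cong (_∧ allᵇ (notAdj d) J) (trans
                  (allᵇ-cong (All.map (λ {c} c∈row → trans (cong not (adjᵇ-sym n d c))
                                                           (crossing c∈row d-later))
                                      inRow))
                  (cols-before (row d)))))
               later) ⟩
        allᵇ (λ d → (m <ᵇ row d) ∧ allᵇ (notAdj d) J) J
          ≡⟨ allᵇ-∧ (λ d → m <ᵇ row d) (λ d → allᵇ (notAdj d) J) J ⟩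
        afterRowᵇ m J ∧ independentᵇ n J ∎

    rowsOccupied-split : ∀ {J} → All (RowsFrom n (suc a)) J →
      rowsOccupied n (pre ++ J) ≡ suc (rowsOccupied n J)
    rowsOccupied-split {J} later = begin
      countᵇ (λ r → anyᵇ (λ c → row c ≡ᵇ r) (pre ++ J)) (range 1 n)
        ≡⟨ countᵇ-cong (All.universal (λ r → trans (anyᵇ-++ (λ c → row c ≡ᵇ r) pre J)
                                                  (cong (_∨ rowInJ r) (rows-of-prefix r))) (range 1 n)) ⟩
      countᵇ (λ r → (a ≡ᵇ r) ∨ rowInJ r) (range 1 n)
        ≡⟨ countᵇ-∨ {p = a ≡ᵇ_} {rowInJ} (All.universal disjoint (range 1 n)) ⟩
      countᵇ (a ≡ᵇ_) (range 1 n) + rowsOccupied n J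
        ≡⟨ cong (_+ rowsOccupied n J) (countᵇ-range-once 1≤a a≤n) ⟩
      suc (rowsOccupied n J) ∎
      where
      open ≡-Reasoning
      rowInJ : ℕ → Bool
      rowInJ r = anyᵇ (λ c → row c ≡ᵇ r) J

      disjoint : ∀ r → (a ≡ᵇ r) ∧ rowInJ r ≡ false
      disjoint r with a ≟ r
      ... | yes refl rewrite reflects-true (≡ᵇ-reflects-≡ a a) refl =
        anyᵇ-false (All.map (λ (a<i , _) → reflects-false (≡ᵇ-reflects-≡ _ a) (<⇒≢ a<i ∘ sym)) later)
      ... | no a≢r rewrite reflects-false (≡ᵇ-reflects-≡ a r) a≢r = refl

    countedᵇ-split : ∀ {J} → All (RowsFrom n (suc a)) J → ∀ k ℓ →
      countedᵇ (length pre + k) (suc ℓ) (pre ++ J) ≡ afterRowᵇ m J ∧ countedᵇ k ℓ J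
    countedᵇ-split {J} later k ℓ
      rewrite independentᵇ-split later | length-++ pre {J} | ≡ᵇ-+ˡ (length pre) (length J) k
            | rowsOccupied-split later = ∧-assoc (afterRowᵇ m J) _ _

  private
    skip-rows : ∀ {m} (P : List Cell → Bool) → m ≤ n → ∀ d {b} → d + b ≡ suc m →
      countᵇ (λ J → afterRowᵇ m J ∧ P J) (subsets (cellsFrom n b)) ≡
      countᵇ (λ J → afterRowᵇ m J ∧ P J) (subsets (cellsFrom n (suc m)))
    skip-rows P m≤n zero    refl = refl
    skip-rows {m} P m≤n (suc d) {b} eq = begin
      countᵇ Q (subsets (cellsFrom n b))
        ≡⟨ cong (countᵇ Q ∘ subsets) (cellsFrom-suc (≤-trans b≤m m≤n)) ⟩
      countᵇ Q (subsets (map (b ,_) (range b n) ++ cellsFrom n (suc b)))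
        ≡⟨ countᵇ-subsets-skip (λ c → m <ᵇ row c) P (map (b ,_) (range b n)) (cellsFrom n (suc b))
             (map⁺ (All.universal (λ _ → reflects-false (<ᵇ-reflects-< m b) (≤⇒≯ b≤m)) (range b n))) ⟩
      countᵇ Q (subsets (cellsFrom n (suc b)))
        ≡⟨ skip-rows P m≤n d (trans (+-suc d b) eq) ⟩
      countᵇ Q (subsets (cellsFrom n (suc m))) ∎
      where
      open ≡-Reasoning
      Q : List Cell → Bool
      Q J = afterRowᵇ m J ∧ P J
      b≤m : b ≤ m
      b≤m = ≤-trans (m≤n+m b d) (≤-reflexive (suc-injective eq))

  count-afterRow : ∀ {a m} (P : List Cell → Bool) → a ≤ m → m ≤ n →
    countᵇ (λ J → afterRowᵇ m J ∧ P J) (subsets (cellsFrom n (suc a))) ≡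
    countᵇ P (subsets (cellsFrom n (suc m)))
  count-afterRow {a} {m} P a≤m m≤n = trans
    (skip-rows P m≤n (m ∸ a) (trans (+-suc (m ∸ a) a) (cong suc (m∸n+n≡m a≤m))))
    (countᵇ-cong (All.map (λ later → cong (_∧ P _) (allᵇ-true (All.map
                            (λ (m<i , _) → reflects-true (<ᵇ-reflects-< m _) m<i) later)))
                          (subsets⁺ (cellsFrom-rows n (suc m)))))

  module Row {a} (1≤a : 1 ≤ a) (a≤n : a ≤ n)
             (ih : ∀ {b} → a < b → b ≤ suc n → ∀ k ℓ → count b k ℓ ≡ ind (suc n ∸ b) k ℓ) where

    completions : List Cell → ℕ → ℕ → ℕ → ℕ
    completions pre c k ℓ =
      countᵇ (λ J → countedᵇ k ℓ (pre ++ J)) (subsets (map (a ,_) (range c n) ++ cellsFrom n (suc a)))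

    completions-none : ∀ pre c k ℓ → (∀ J → countedᵇ k ℓ (pre ++ J) ≡ false) →
      completions pre c k ℓ ≡ 0
    completions-none pre c k ℓ none =
      countᵇ-none (All.universal none (subsets (map (a ,_) (range c n) ++ cellsFrom n (suc a))))

    completions-step : ∀ pre {c} → c ≤ n → ∀ k ℓ →
      completions pre c k ℓ ≡ completions pre (suc c) k ℓ + completions (pre ++ (a , c) ∷ []) (suc c) k ℓ
    completions-step pre {c} c≤n k ℓ rewrite range-suc c≤n =
      trans (countᵇ-subsets-∷ (λ J → countedᵇ k ℓ (pre ++ J)) (a , c) rest)
            (cong (completions pre (suc c) k ℓ +_)
                  (countᵇ-cong (All.universal
                    (λ J → cong (countedᵇ k ℓ) (sym (++-assoc pre ((a , c) ∷ []) J))) (subsets rest))))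
      where
      rest : List Cell
      rest = map (a ,_) (range (suc c) n) ++ cellsFrom n (suc a)

    completions-rowDone : ∀ pre k ℓ →
      completions pre (suc n) k ℓ ≡
      countᵇ (λ J → countedᵇ k ℓ (pre ++ J)) (subsets (cellsFrom n (suc a)))
    completions-rowDone pre k ℓ =
      cong (λ cs → countᵇ (λ J → countedᵇ k ℓ (pre ++ J)) (subsets (map (a ,_) cs ++ cellsFrom n (suc a))))
           (range-empty (n<1+n n))

    completions-rowDone-prefix : ∀ {m} pre → RowPrefix a m pre → m ≤ n → ∀ k ℓ →
      completions pre (suc n) (length pre + k) (suc ℓ) ≡ ind (n ∸ m) k ℓ
    completions-rowDone-prefix {m} pre prefix m≤n k ℓ = begin
      completions pre (suc n) (length pre + k) (suc ℓ)
        ≡⟨ completions-rowDone pre (length pre + k) (suc ℓ) ⟩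
      countᵇ (λ J → countedᵇ (length pre + k) (suc ℓ) (pre ++ J)) (subsets (cellsFrom n (suc a)))
        ≡⟨ countᵇ-cong (All.map (λ later → countedᵇ-split 1≤a m≤n prefix later k ℓ)
                                (subsets⁺ (cellsFrom-rows n (suc a)))) ⟩
      countᵇ (λ J → afterRowᵇ m J ∧ countedᵇ k ℓ J) (subsets (cellsFrom n (suc a)))
        ≡⟨ count-afterRow (countedᵇ k ℓ) (RowPrefix-a≤m prefix) m≤n ⟩
      count (suc m) k ℓ
        ≡⟨ ih (s≤s (RowPrefix-a≤m prefix)) (s≤s m≤n) k ℓ ⟩
      ind (n ∸ m) k ℓ ∎
      where open ≡-Reasoning

    private
      widen : ∀ {c d} → InRow a c d → InRow a (suc c) d
      widen (e , a≤j , j≤c) = e , a≤j , m≤n⇒m≤1+n j≤c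

    -- Row a is scanned from column c on; when (a , c) is added it is the largest column chosen so far.
    mutual
      completions-columns : ∀ u {pre c} → All (InRow a c) pre → a ≤ c → c + u ≡ suc n → ∀ k ℓ →
        completions pre c (length pre + k) ℓ ≡ completions pre (suc n) (length pre + k) ℓ + indTop u k ℓ
      completions-columns zero {c = c} _ _ c+0≡1+n k ℓ
        rewrite trans (sym (+-identityʳ c)) c+0≡1+n = sym (+-identityʳ _)
      completions-columns (suc u) {pre} {c} pre-row a≤c eq k ℓ = begin
        completions pre c K ℓ
          ≡⟨ completions-step pre (m+n≤o⇒m≤o c (≤-reflexive c+u≡n)) K ℓ ⟩
        completions pre (suc c) K ℓ + completions (pre ++ (a , c) ∷ []) (suc c) K ℓ
          ≡⟨ cong₂ _+_ (completions-columns u (All.map widen pre-row) (m≤n⇒m≤1+n a≤c)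
                                            (trans (sym (+-suc c u)) eq) k ℓ)
                       (completions-chosen u pre-row a≤c eq k ℓ) ⟩
        (completions pre (suc n) K ℓ + indTop u k ℓ) + indTop₁ u k ℓ
          ≡⟨ +-assoc (completions pre (suc n) K ℓ) _ _ ⟩
        completions pre (suc n) K ℓ + indTop (suc u) k ℓ ∎
        where
        open ≡-Reasoning
        K = length pre + k
        c+u≡n : c + u ≡ n
        c+u≡n = suc-injective (trans (sym (+-suc c u)) eq)

      completions-chosen : ∀ u {pre c} → All (InRow a c) pre → a ≤ c → c + suc u ≡ suc n → ∀ k ℓ →
        completions (pre ++ (a , c) ∷ []) (suc c) (length pre + k) ℓ ≡ indTop₁ u k ℓ
      completions-chosen u {pre} {c} _ _ _ zero ℓ =
        completions-none pre′ (suc c) (length pre + 0) ℓ (λ J → countedᵇ-tooBig ℓ pre′ J too-big)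
        where
        pre′ = pre ++ (a , c) ∷ []
        too-big : length pre + 0 < length pre′
        too-big rewrite +-identityʳ (length pre) | length-++ pre {(a , c) ∷ []} | +-comm (length pre) 1 = ≤-refl
      completions-chosen u {pre} {c} _ _ _ (suc k) zero =
        completions-none pre′ (suc c) (length pre + suc k) 0
          (λ J → countedᵇ-noRows (length pre + suc k) (pre′ ++ J) 1≤a a≤n
                                 (∈-++⁺ˡ (∈-++⁺ʳ pre (here refl))))
        where
        pre′ = pre ++ (a , c) ∷ []
      completions-chosen u {pre} {c} pre-row a≤c eq (suc k) (suc ℓ) = begin
        completions pre′ (suc c) (length pre + suc k) (suc ℓ)
          ≡⟨ cong (λ K → completions pre′ (suc c) K (suc ℓ))
                  (sym (trans (cong (_+ k) (length-++ pre)) (+-assoc (length pre) 1 k))) ⟩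
        completions pre′ (suc c) (length pre′ + k) (suc ℓ)
          ≡⟨ completions-columns u (All.map widen (RowPrefix.inRow prefix)) (m≤n⇒m≤1+n a≤c)
                                 (trans (sym (+-suc c u)) eq) k (suc ℓ) ⟩
        completions pre′ (suc n) (length pre′ + k) (suc ℓ) + indTop u k (suc ℓ)
          ≡⟨ cong (_+ indTop u k (suc ℓ))
                  (completions-rowDone-prefix pre′ prefix (m+n≤o⇒m≤o c (≤-reflexive c+u≡n)) k ℓ) ⟩
        ind (n ∸ c) k ℓ + indTop u k (suc ℓ)
          ≡⟨ cong (λ t → ind t k ℓ + indTop u k (suc ℓ))
                  (trans (cong (_∸ c) (sym c+u≡n)) (m+n∸m≡n c u)) ⟩
        ind u k ℓ + indTop u k (suc ℓ) ∎
        where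
        open ≡-Reasoning
        pre′ : List Cell
        pre′ = pre ++ (a , c) ∷ []
        prefix : RowPrefix a c pre′
        prefix = record { inRow   = ++⁺ pre-row ((refl , a≤c , ≤-refl) ∷ [])
                        ; lastCol = ∈-++⁺ʳ pre (here refl) }
        c+u≡n : c + u ≡ n
        c+u≡n = suc-injective (trans (sym (+-suc c u)) eq)

    count-row : ∀ k ℓ → count a k ℓ ≡ ind (suc n ∸ a) k ℓ
    count-row k ℓ = begin
      count a k ℓ
        ≡⟨ cong (countᵇ (countedᵇ k ℓ) ∘ subsets) (cellsFrom-suc a≤n) ⟩
      completions [] a k ℓ
        ≡⟨ completions-columns (suc (n ∸ a)) [] ≤-refl
                               (trans (+-suc a (n ∸ a)) (cong suc (m+[n∸m]≡n a≤n))) k ℓ ⟩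
      completions [] (suc n) k ℓ + indTop (suc (n ∸ a)) k ℓ
        ≡⟨ cong (_+ indTop (suc (n ∸ a)) k ℓ)
                (trans (completions-rowDone [] k ℓ) (ih (n<1+n a) (s≤s a≤n) k ℓ)) ⟩
      ind (suc (n ∸ a)) k ℓ
        ≡⟨ cong (λ t → ind t k ℓ) (sym (+-∸-assoc 1 a≤n)) ⟩
      ind (suc n ∸ a) k ℓ ∎
      where open ≡-Reasoning

  count-empty : ∀ {a} → n < a → ∀ k ℓ → count a k ℓ ≡ ind 0 k ℓ
  count-empty n<a k ℓ
    rewrite cellsFrom-empty n<a | countᵇ-none {p = λ _ → false} (All.universal (λ _ → refl) (range 1 n))
    = base k ℓ
    where
    base : ∀ k ℓ → (if (0 ≡ᵇ k) ∧ (0 ≡ᵇ ℓ) then 1 else 0) + 0 ≡ ind 0 k ℓ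
    base zero    zero    = refl
    base zero    (suc ℓ) = refl
    base (suc k) ℓ       = refl

  count-rows : ∀ a → 1 ≤ a → ∀ k ℓ → count a k ℓ ≡ ind (suc n ∸ a) k ℓ
  count-rows = WF.All.wfRec (On.wellFounded (suc n ∸_) <-wellFounded) 0ℓ P step
    where
    P : ℕ → Set
    P a = 1 ≤ a → ∀ k ℓ → count a k ℓ ≡ ind (suc n ∸ a) k ℓ
    step : ∀ a → (∀ {b} → suc n ∸ b < suc n ∸ a → P b) → P a
    step a rec 1≤a with a ≤? n
    ... | yes a≤n = Row.count-row 1≤a a≤n
                      (λ a<b b≤1+n → rec (∸-monoʳ-< a<b b≤1+n) (≤-trans 1≤a (<⇒≤ a<b)))
    ... | no  a≰n = λ k ℓ → trans (count-empty (≰⇒> a≰n) k ℓ)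
                                  (cong (λ t → ind t k ℓ) (sym (m≤n⇒m∸n≡0 (≰⇒> a≰n))))

numIndep≡ind : ∀ n k ℓ → numIndep n k ℓ ≡ ind n k ℓ
numIndep≡ind n = Counting.count-rows n 1 ≤-refl

-- Power series

open import Data.Integer using (ℤ; +_; -_; _-_) renaming (_+_ to _+ℤ_; _*_ to _*ℤ_)
import Data.Integer.Properties as ℤ
open import Data.Integer.Tactic.RingSolver using (solve-∀)

sumℤ-++ : ∀ xs ys → sumℤ (xs ++ ys) ≡ sumℤ xs +ℤ sumℤ ys
sumℤ-++ []       ys = sym (ℤ.+-identityˡ _)
sumℤ-++ (x ∷ xs) ys = trans (cong (x +ℤ_) (sumℤ-++ xs ys)) (sym (ℤ.+-assoc x _ _))

sumℤ-concatMap : ∀ (f : A → List ℤ) xs → sumℤ (concatMap f xs) ≡ sumℤ (map (sumℤ ∘ f) xs)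
sumℤ-concatMap f []       = refl
sumℤ-concatMap f (x ∷ xs) =
  trans (sumℤ-++ (f x) (concatMap f xs)) (cong (sumℤ (f x) +ℤ_) (sumℤ-concatMap f xs))

Σ≤ : ℕ → (ℕ → ℤ) → ℤ
Σ≤ m g = sumℤ (map g (range 0 m))

Σ≤-cong : ∀ m {g h : ℕ → ℤ} → (∀ i → g i ≡ h i) → Σ≤ m g ≡ Σ≤ m h
Σ≤-cong m g≗h = cong sumℤ (map-cong g≗h (range 0 m))

Σ≤-zero : ∀ m {g : ℕ → ℤ} → (∀ i → g i ≡ + 0) → Σ≤ m g ≡ + 0
Σ≤-zero m {g} g≗0 = go (range 0 m)
  where
  go : ∀ is → sumℤ (map g is) ≡ + 0
  go []       = refl
  go (i ∷ is) rewrite g≗0 i = trans (ℤ.+-identityˡ _) (go is)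

Σ≤-support : ∀ d m {g : ℕ → ℤ} → (∀ {i} → d < i → g i ≡ + 0) → Σ≤ m g ≡ Σ≤ (d ⊓ m) g
Σ≤-support d m {g} vanish = range-ind (λ a is → sumℤ (map g is) ≡ sumℤ (map g (range a (d ⊓ m))))
  (λ m<a → sym (cong (sumℤ ∘ map g) (range-empty (≤-<-trans (m⊓n≤n d m) m<a)))) step 0
  where
  step : ∀ {a} → a ≤ m → sumℤ (map g (range (suc a) m)) ≡ sumℤ (map g (range (suc a) (d ⊓ m))) →
         sumℤ (map g (a ∷ range (suc a) m)) ≡ sumℤ (map g (range a (d ⊓ m)))
  step {a} a≤m rest with a ≤? d
  ... | yes a≤d rewrite range-suc (⊓-glb a≤d a≤m) = cong (g a +ℤ_) rest
  ... | no  a≰d rewrite vanish (≰⇒> a≰d) | range-empty (≤-<-trans (m⊓n≤m d m) (≰⇒> a≰d))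
                      | range-empty (≤-<-trans (m⊓n≤m d m) (m≤n⇒m≤1+n (≰⇒> a≰d)))
    = trans (ℤ.+-identityˡ _) rest

⋆-nested : ∀ f g n k ℓ → (f ⋆ g) n k ℓ ≡
  Σ≤ n (λ a → Σ≤ k (λ b → Σ≤ ℓ (λ c → f a b c *ℤ g (n ∸ a) (k ∸ b) (ℓ ∸ c))))
⋆-nested f g n k ℓ =
  trans (sumℤ-concatMap (λ a → concatMap (λ b → map (term a b) (range 0 ℓ)) (range 0 k)) (range 0 n))
        (Σ≤-cong n (λ a → sumℤ-concatMap (λ b → map (term a b) (range 0 ℓ)) (range 0 k)))
  where
  term : ℕ → ℕ → ℕ → ℤ
  term a b c = f a b c *ℤ g (n ∸ a) (k ∸ b) (ℓ ∸ c)

⋆-congʳ : ∀ f {g h} n k ℓ →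
  (∀ a b c → g (n ∸ a) (k ∸ b) (ℓ ∸ c) ≡ h (n ∸ a) (k ∸ b) (ℓ ∸ c)) →
  (f ⋆ g) n k ℓ ≡ (f ⋆ h) n k ℓ
⋆-congʳ f n k ℓ g≗h = cong sumℤ
  (concatMap-cong (λ a → concatMap-cong (λ b → map-cong (λ c → cong (f a b c *ℤ_) (g≗h a b c))
                                                         (range 0 ℓ)) (range 0 k)) (range 0 n))

denom-x : ∀ {a} b c → 2 < a → denom a b c ≡ + 0
denom-x b c (s≤s (s≤s (s≤s _))) = refl

denom-y : ∀ a {b} c → 1 < b → denom a b c ≡ + 0
denom-y zero                      c (s≤s (s≤s _)) = refl
denom-y (suc zero)                c (s≤s (s≤s _)) = refl
denom-y (suc (suc zero))          c (s≤s (s≤s _)) = refl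
denom-y (suc (suc (suc a)))       c (s≤s (s≤s _)) = refl

denom-z : ∀ a b {c} → 1 < c → denom a b c ≡ + 0
denom-z zero                zero             (s≤s (s≤s _)) = refl
denom-z zero                (suc b)          (s≤s (s≤s _)) = refl
denom-z (suc zero)          zero             (s≤s (s≤s _)) = refl
denom-z (suc zero)          (suc zero)       (s≤s (s≤s _)) = refl
denom-z (suc zero)          (suc (suc b))    (s≤s (s≤s _)) = refl
denom-z (suc (suc zero))    zero             (s≤s (s≤s _)) = refl
denom-z (suc (suc zero))    (suc zero)       (s≤s (s≤s _)) = refl
denom-z (suc (suc zero))    (suc (suc b))    (s≤s (s≤s _)) = refl
denom-z (suc (suc (suc a))) b                (s≤s (s≤s _)) = refl

denomBox : Series3 → Series3
denomBox A n k ℓ =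
  Σ≤ (2 ⊓ n) λ a → Σ≤ (1 ⊓ k) λ b → Σ≤ (1 ⊓ ℓ) λ c →
    denom a b c *ℤ A (n ∸ a) (k ∸ b) (ℓ ∸ c)

denom⋆≡denomBox : ∀ A n k ℓ → (denom ⋆ A) n k ℓ ≡ denomBox A n k ℓ
denom⋆≡denomBox A n k ℓ = begin
  (denom ⋆ A) n k ℓ
    ≡⟨ ⋆-nested denom A n k ℓ ⟩
  Σ≤ n (λ a → Σ≤ k (λ b → Σ≤ ℓ (term a b)))
    ≡⟨ Σ≤-cong n (λ a → Σ≤-cong k (λ b → Σ≤-support 1 ℓ {term a b}
         (λ {c} 1<c → zero-coefficient a b c (denom-z a b 1<c)))) ⟩
  Σ≤ n (λ a → Σ≤ k (λ b → Σ≤ (1 ⊓ ℓ) (term a b)))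
    ≡⟨ Σ≤-cong n (λ a → Σ≤-support 1 k {λ b → Σ≤ (1 ⊓ ℓ) (term a b)}
         (λ {b} 1<b → Σ≤-zero (1 ⊓ ℓ) (λ c → zero-coefficient a b c (denom-y a c 1<b)))) ⟩
  Σ≤ n (λ a → Σ≤ (1 ⊓ k) (λ b → Σ≤ (1 ⊓ ℓ) (term a b)))
    ≡⟨ Σ≤-support 2 n {λ a → Σ≤ (1 ⊓ k) (λ b → Σ≤ (1 ⊓ ℓ) (term a b))}
         (λ {a} 2<a → Σ≤-zero (1 ⊓ k) (λ b → Σ≤-zero (1 ⊓ ℓ) (λ c →
                        zero-coefficient a b c (denom-x b c 2<a)))) ⟩
  denomBox A n k ℓ ∎
  where
  open ≡-Reasoning
  term : ℕ → ℕ → ℕ → ℤ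
  term a b c = denom a b c *ℤ A (n ∸ a) (k ∸ b) (ℓ ∸ c)
  zero-coefficient : ∀ a b c → denom a b c ≡ + 0 → term a b c ≡ + 0
  zero-coefficient a b c e = cong (_*ℤ A (n ∸ a) (k ∸ b) (ℓ ∸ c)) e

IND : Series3
IND n k ℓ = + ind n k ℓ

-- denomBox IND (2 + n) (1 + k) (1 + ℓ) unfolds to the left-hand side, with p, …, u the values of IND
-- at the six monomials of denom.
denomBox-shape : ∀ p q r s t u →
    ((+ 1 *ℤ p +ℤ (+ 0 +ℤ + 0)) +ℤ ((+ 0 +ℤ (+ 0 +ℤ + 0)) +ℤ + 0))
  +ℤ (((- (+ 2) *ℤ q +ℤ (+ 0 +ℤ + 0)) +ℤ ((- (+ 1) *ℤ r +ℤ (- (+ 1) *ℤ s +ℤ + 0)) +ℤ + 0))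
  +ℤ (((+ 1 *ℤ t +ℤ (+ 0 +ℤ + 0)) +ℤ ((+ 1 *ℤ u +ℤ (+ 0 +ℤ + 0)) +ℤ + 0)) +ℤ + 0))
  ≡ p +ℤ t +ℤ u - (q +ℤ q +ℤ r +ℤ s)
denomBox-shape = solve-∀

denomBox-IND : ∀ n k ℓ → denomBox IND (2 + n) (suc k) (suc ℓ) ≡ + 0
denomBox-IND n k ℓ = begin
  denomBox IND (2 + n) (suc k) (suc ℓ)
    ≡⟨ denomBox-shape (IND (2 + n) (suc k) (suc ℓ)) (IND (1 + n) (suc k) (suc ℓ)) (IND (1 + n) k (suc ℓ))
                      (IND (1 + n) k ℓ) (IND n (suc k) (suc ℓ)) (IND n k (suc ℓ)) ⟩
  + (ind (2 + n) (suc k) (suc ℓ) + ind n (suc k) (suc ℓ) + ind n k (suc ℓ)) - + Q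
    ≡⟨ cong (λ m → + m - + Q) (ind-recurrence n k ℓ) ⟩
  + Q - + Q
    ≡⟨ ℤ.+-inverseʳ (+ Q) ⟩
  + 0 ∎
  where
  open ≡-Reasoning
  Q : ℕ
  Q = ind (1 + n) (suc k) (suc ℓ) + ind (1 + n) (suc k) (suc ℓ) + ind (1 + n) k (suc ℓ) + ind (1 + n) k ℓ

-- With no cells or no rows, the coefficients of IND do not depend on n.
IND₀ : Series3
IND₀ n k ℓ = IND 0 k ℓ

IND-size₀ : ∀ t b ℓ → IND t (0 ∸ b) ℓ ≡ IND₀ t (0 ∸ b) ℓ
IND-size₀ t b ℓ rewrite 0∸n≡0 b = cong +_ (ind-size₀ t ℓ)

IND-rows₀ : ∀ t k c → IND t k (0 ∸ c) ≡ IND₀ t k (0 ∸ c)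
IND-rows₀ t k c rewrite 0∸n≡0 c = cong +_ (ind-rows₀ t k)

denom⋆IND-size₀ : ∀ n ℓ → (denom ⋆ IND) n 0 ℓ ≡ numer n 0 ℓ
denom⋆IND-size₀ n ℓ = begin
  (denom ⋆ IND) n 0 ℓ  ≡⟨ ⋆-congʳ denom {IND} {IND₀} n 0 ℓ (λ a b c → IND-size₀ (n ∸ a) b (ℓ ∸ c)) ⟩
  (denom ⋆ IND₀) n 0 ℓ ≡⟨ denom⋆≡denomBox IND₀ n 0 ℓ ⟩
  denomBox IND₀ n 0 ℓ  ≡⟨ box n ℓ ⟩
  numer n 0 ℓ          ∎
  where
  open ≡-Reasoning
  box : ∀ n ℓ → denomBox IND₀ n 0 ℓ ≡ numer n 0 ℓ
  box 0             0       = refl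
  box 0             (suc ℓ) = refl
  box 1             0       = refl
  box 1             (suc ℓ) = refl
  box (suc (suc n)) 0       = refl
  box (suc (suc n)) (suc ℓ) = refl

denom⋆IND-rows₀ : ∀ n k → (denom ⋆ IND) n k 0 ≡ numer n k 0
denom⋆IND-rows₀ n k = begin
  (denom ⋆ IND) n k 0  ≡⟨ ⋆-congʳ denom {IND} {IND₀} n k 0 (λ a b c → IND-rows₀ (n ∸ a) (k ∸ b) c) ⟩
  (denom ⋆ IND₀) n k 0 ≡⟨ denom⋆≡denomBox IND₀ n k 0 ⟩
  denomBox IND₀ n k 0  ≡⟨ box n k ⟩
  numer n k 0          ∎
  where
  open ≡-Reasoning
  box : ∀ n k → denomBox IND₀ n k 0 ≡ numer n k 0
  box 0             0             = refl
  box 0             (suc k)       = refl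
  box 1             0             = refl
  box 1             1             = refl
  box 1             (suc (suc k)) = refl
  box (suc (suc n)) 0             = refl
  box (suc (suc n)) 1             = refl
  box (suc (suc n)) (suc (suc k)) = refl

denom⋆IND : ∀ n k ℓ → (denom ⋆ IND) n k ℓ ≡ numer n k ℓ
denom⋆IND n             zero    ℓ       = denom⋆IND-size₀ n ℓ
denom⋆IND n             (suc k) zero    = denom⋆IND-rows₀ n (suc k)
denom⋆IND zero          (suc k) (suc ℓ) = denom⋆≡denomBox IND 0 (suc k) (suc ℓ)
denom⋆IND 1             (suc k) (suc ℓ) = trans (denom⋆≡denomBox IND 1 (suc k) (suc ℓ)) (box k ℓ)
  where
  box : ∀ k ℓ → denomBox IND 1 (suc k) (suc ℓ) ≡ numer 1 (suc k) (suc ℓ)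
  box zero    zero    = refl
  box zero    (suc ℓ) = refl
  box (suc k) zero    = refl
  box (suc k) (suc ℓ) = refl
denom⋆IND (suc (suc n)) (suc k) (suc ℓ) =
  trans (denom⋆≡denomBox IND (2 + n) (suc k) (suc ℓ)) (denomBox-IND n k ℓ)

proposition6p2 : IsQuotient (λ n k ℓ → + numIndep n k ℓ) numer denom
proposition6p2 n k ℓ = begin
  (denom ⋆ (λ n k ℓ → + numIndep n k ℓ)) n k ℓ
    ≡⟨ ⋆-congʳ denom {λ n k ℓ → + numIndep n k ℓ} {IND} n k ℓ
               (λ a b c → cong +_ (numIndep≡ind (n ∸ a) (k ∸ b) (ℓ ∸ c))) ⟩
  (denom ⋆ IND) n k ℓ
    ≡⟨ denom⋆IND n k ℓ ⟩
  numer n k ℓ ∎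
  where open ≡-Reasoning
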